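{- Let $T^*$ be a tournament, let $\pi$ be a permutation of $V(T^*)$, and suppose that the graph $T^*_L(\pi)$ contains a (not necessarily induced) $4$-cycle on vertices $a,b,c,d$ where $\pi(a)<\pi(b)<\pi(c)<\pi(d)$. Then there are two sets $X,Y$ of three vertices each such that inverting $X$ and then $Y$ reverses the direction of the (tournament edges corresponding to the) edges of the $4$-cycle without affecting the direction of any other edge of $T^*$.
   Context: For a digraph $D$ and a permutation $\pi$ of $V(D)$ (viewed as a bijection $V(D)\to\{1,\dots,|V(D)|\}$), $D_L(\pi)$ is the undirected simple graph on $V(D)$ in which $\{i,j\}$ is an edge iff $(i,j)\in E(D)$ and $\pi(i)<\pi(j)$. Inverting a vertex set $X$ means reversing the direction of every edge with both endpoints in $X$. -}

module Defs where

open import Data.Nat using (ℕ)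
open import Data.Fin using (Fin; _<_)
open import Data.Fin.Subset using (Subset; _∈_)
open import Data.Fin.Permutation using (Permutation′; _⟨$⟩ʳ_)
open import Data.Product using (_×_)
open import Data.Sum using (_⊎_)
open import Relation.Nullary using (¬_)
open import Relation.Binary.PropositionalEquality using (_≡_; _≢_)

Digraph : ℕ → Set₁
Digraph n = Fin n → Fin n → Set

record IsTournament {n : ℕ} (T : Digraph n) : Set where
  field
    loopless : ∀ u → ¬ T u u
    asym     : ∀ u v → T u v → ¬ T v u
    total    : ∀ u v → u ≢ v → T u v ⊎ T v u

DL : {n : ℕ} → Digraph n → Permutation′ n → Fin n → Fin n → Set
DL D π i j = (D i j × (π ⟨$⟩ʳ i) < (π ⟨$⟩ʳ j)) ⊎ (D j i × (π ⟨$⟩ʳ j) < (π ⟨$⟩ʳ i))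

invert : {n : ℕ} → Subset n → Digraph n → Digraph n
invert X D u v = (u ∈ X × v ∈ X × D v u) ⊎ (¬ (u ∈ X × v ∈ X) × D u v)

CycleEdge : {n : ℕ} → (a b c d u v : Fin n) → Set
CycleEdge a b c d u v =
  ((u ≡ a × v ≡ b) ⊎ (u ≡ b × v ≡ a)) ⊎
  ((u ≡ b × v ≡ c) ⊎ (u ≡ c × v ≡ b)) ⊎
  ((u ≡ c × v ≡ d) ⊎ (u ≡ d × v ≡ c)) ⊎
  ((u ≡ d × v ≡ a) ⊎ (u ≡ a × v ≡ d))

reverseCycle : {n : ℕ} → (a b c d : Fin n) → Digraph n → Digraph n
reverseCycle a b c d D u v = (CycleEdge a b c d u v × D v u) ⊎ (¬ CycleEdge a b c d u v × D u v)

-- Take X = {w, x, y} and Y = {y, z, w}.  The pairs inside X are the cycle edges wx, xy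
-- and the chord wy; the pairs inside Y are the cycle edges yz, zw and the same chord.
-- Inverting X and then Y therefore reverses every cycle edge once and the chord twice,
-- and leaves every other pair alone.
module Submission where

open import Defs
open import Data.Nat using (ℕ; suc)
open import Data.Fin using (Fin; _<_; zero; suc; _≟_)
open import Data.Fin.Subset using (Subset; ∣_∣; _∈_; _∉_; ⁅_⁆; _∪_; inside; outside)
open import Data.Fin.Subset.Properties
  using (x∈p∪q⁻; x∈p∪q⁺; x∈⁅y⁆⇒x≡y; x∈⁅x⁆; x≢y⇒x∉⁅y⁆; ∪-identityˡ; _∈?_; ∣⁅x⁆∣≡1)
open import Data.Vec using (_∷_; here; there)
open import Data.Fin.Permutation using (Permutation′; _⟨$⟩ʳ_)
open import Data.Product using (_×_; Σ-syntax; _,_; proj₁; proj₂; swap)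
open import Data.Sum using (_⊎_; inj₁; inj₂; [_,_]; assocˡ; assocʳ)
open import Level using (0ℓ)
open import Relation.Nullary using (¬_; yes; no; contradiction)
open import Relation.Nullary.Decidable using (_×-dec_)
open import Relation.Binary.PropositionalEquality using (_≡_; _≢_; refl; sym; cong; trans)
open import Function.Base using (_∘_)
open import Function.Bundles using (_⇔_; mk⇔; Equivalence)
open Equivalence using (to; from)
import Function.Properties.Equivalence as ⇔
open import Relation.Binary.Reasoning.Setoid (⇔.⇔-setoid 0ℓ)

private
  variable
    n : ℕ

triple : Fin n → Fin n → Fin n → Subset n
triple p q r = ⁅ p ⁆ ∪ (⁅ q ⁆ ∪ ⁅ r ⁆)

x∈triple⁺ : ∀ {p q r x : Fin n} → x ≡ p ⊎ x ≡ q ⊎ x ≡ r → x ∈ triple p q r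
x∈triple⁺ (inj₁ refl)                    = x∈p∪q⁺ (inj₁ (x∈⁅x⁆ _))
x∈triple⁺ {p = p} (inj₂ (inj₁ refl))     = x∈p∪q⁺ {p = ⁅ p ⁆} (inj₂ (x∈p∪q⁺ (inj₁ (x∈⁅x⁆ _))))
x∈triple⁺ {p = p} {q} (inj₂ (inj₂ refl)) =
  x∈p∪q⁺ {p = ⁅ p ⁆} (inj₂ (x∈p∪q⁺ {p = ⁅ q ⁆} (inj₂ (x∈⁅x⁆ _))))

p∈triple : ∀ {p q r : Fin n} → p ∈ triple p q r
p∈triple = x∈triple⁺ (inj₁ refl)

q∈triple : ∀ {p q r : Fin n} → q ∈ triple p q r
q∈triple = x∈triple⁺ (inj₂ (inj₁ refl))

r∈triple : ∀ {p q r : Fin n} → r ∈ triple p q r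
r∈triple = x∈triple⁺ (inj₂ (inj₂ refl))

x∈triple⁻ : ∀ {p q r x : Fin n} → x ∈ triple p q r → x ≡ p ⊎ x ≡ q ⊎ x ≡ r
x∈triple⁻ {p = p} {q} {r} x∈ with x∈p∪q⁻ ⁅ p ⁆ (⁅ q ⁆ ∪ ⁅ r ⁆) x∈
... | inj₁ x∈p = inj₁ (x∈⁅y⁆⇒x≡y p x∈p)
... | inj₂ x∈qr with x∈p∪q⁻ ⁅ q ⁆ ⁅ r ⁆ x∈qr
...   | inj₁ x∈q = inj₂ (inj₁ (x∈⁅y⁆⇒x≡y q x∈q))
...   | inj₂ x∈r = inj₂ (inj₂ (x∈⁅y⁆⇒x≡y r x∈r))

x∉triple : ∀ {p q r x : Fin n} → x ≢ p → x ≢ q → x ≢ r → x ∉ triple p q r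
x∉triple x≢p x≢q x≢r x∈ = [ x≢p , [ x≢q , x≢r ] ] (x∈triple⁻ x∈)

x∉p⇒∣⁅x⁆∪p∣≡1+∣p∣ : (x : Fin n) (p : Subset n) → x ∉ p → ∣ ⁅ x ⁆ ∪ p ∣ ≡ suc ∣ p ∣
x∉p⇒∣⁅x⁆∪p∣≡1+∣p∣ zero    (outside ∷ p) _   = cong suc (cong ∣_∣ (∪-identityˡ p))
x∉p⇒∣⁅x⁆∪p∣≡1+∣p∣ zero    (inside ∷ p)  x∉p = contradiction here x∉p
x∉p⇒∣⁅x⁆∪p∣≡1+∣p∣ (suc x) (outside ∷ p) x∉p = x∉p⇒∣⁅x⁆∪p∣≡1+∣p∣ x p (λ x∈p → x∉p (there x∈p))
x∉p⇒∣⁅x⁆∪p∣≡1+∣p∣ (suc x) (inside ∷ p)  x∉p =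
  cong suc (x∉p⇒∣⁅x⁆∪p∣≡1+∣p∣ x p (λ x∈p → x∉p (there x∈p)))

∣triple∣≡3 : {p q r : Fin n} → p ≢ q → p ≢ r → q ≢ r → ∣ triple p q r ∣ ≡ 3
∣triple∣≡3 {p = p} {q} {r} p≢q p≢r q≢r = trans
  (x∉p⇒∣⁅x⁆∪p∣≡1+∣p∣ p _ (λ p∈ → [ x≢y⇒x∉⁅y⁆ p≢q , x≢y⇒x∉⁅y⁆ p≢r ] (x∈p∪q⁻ ⁅ q ⁆ ⁅ r ⁆ p∈)))
  (cong suc (trans (x∉p⇒∣⁅x⁆∪p∣≡1+∣p∣ q _ (x≢y⇒x∉⁅y⁆ q≢r)) (cong suc (∣⁅x⁆∣≡1 r))))

reverseOn : Digraph n → Digraph n → Digraph n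
reverseOn C D u v = (C u v × D v u) ⊎ (¬ C u v × D u v)

BothIn : Subset n → Digraph n
BothIn S u v = u ∈ S × v ∈ S

SymDiff : Digraph n → Digraph n → Digraph n
SymDiff P Q u v = (P u v × ¬ Q u v) ⊎ (¬ P u v × Q u v)

module _ (P Q : Digraph n) {u v : Fin n} where

  both⇒¬symDiff : P u v → Q u v → ¬ SymDiff P Q u v
  both⇒¬symDiff Puv Quv = [ (λ (_ , ¬Quv) → ¬Quv Quv) , (λ (¬Puv , _) → ¬Puv Puv) ]

  neither⇒¬symDiff : ¬ P u v → ¬ Q u v → ¬ SymDiff P Q u v
  neither⇒¬symDiff ¬Puv ¬Quv = [ (λ (Puv , _) → ¬Puv Puv) , (λ (_ , Quv) → ¬Quv Quv) ]

module _ (C : Digraph n) (D : Digraph n) {u v : Fin n} where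

  reverseOn-inside : C u v → reverseOn C D u v ⇔ D v u
  reverseOn-inside Cuv = mk⇔ [ proj₂ , (λ (¬Cuv , _) → contradiction Cuv ¬Cuv) ]
                             (λ Dvu → inj₁ (Cuv , Dvu))

  reverseOn-outside : ¬ C u v → reverseOn C D u v ⇔ D u v
  reverseOn-outside ¬Cuv = mk⇔ [ (λ (Cuv , _) → contradiction Cuv ¬Cuv) , proj₂ ]
                               (λ Duv → inj₂ (¬Cuv , Duv))

invert⇔reverseOn : ∀ (S : Subset n) D {u v} → invert S D u v ⇔ reverseOn (BothIn S) D u v
invert⇔reverseOn S D = mk⇔ [ (λ (u∈ , v∈ , Dvu) → inj₁ ((u∈ , v∈) , Dvu)) , inj₂ ]
                       [ (λ ((u∈ , v∈) , Dvu) → inj₁ (u∈ , v∈ , Dvu)) , inj₂ ]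

module _ (S : Subset n) (D : Digraph n) {u v : Fin n} where

  invert-inside : BothIn S u v → invert S D u v ⇔ D v u
  invert-inside inS = ⇔.trans (invert⇔reverseOn S D) (reverseOn-inside (BothIn S) D inS)

  invert-outside : ¬ BothIn S u v → invert S D u v ⇔ D u v
  invert-outside ¬inS = ⇔.trans (invert⇔reverseOn S D) (reverseOn-outside (BothIn S) D ¬inS)

invert-diagonal : ∀ (S : Subset n) D u → invert S D u u ⇔ D u u
invert-diagonal S D u with u ∈? S
... | yes u∈S = invert-inside S D (u∈S , u∈S)
... | no  u∉S = invert-outside S D (u∉S ∘ proj₁)

module _ (X Y : Subset n) (C D : Digraph n) where

  invert-twice-off-diagonal : ∀ {u v} → C u v ⇔ SymDiff (BothIn X) (BothIn Y) u v →
                              invert Y (invert X D) u v ⇔ reverseOn C D u v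
  invert-twice-off-diagonal {u} {v} C⇔SymDiff with u ∈? X ×-dec v ∈? X | u ∈? Y ×-dec v ∈? Y
  ... | yes inX | yes inY = begin
    invert Y (invert X D) u v  ≈⟨ invert-inside Y (invert X D) inY ⟩
    invert X D v u             ≈⟨ invert-inside X D (swap inX) ⟩
    D u v                      ≈⟨ reverseOn-outside C D
                                    (both⇒¬symDiff (BothIn X) (BothIn Y) inX inY ∘ to C⇔SymDiff) ⟨
    reverseOn C D u v          ∎
  ... | yes inX | no ¬inY = begin
    invert Y (invert X D) u v  ≈⟨ invert-outside Y (invert X D) ¬inY ⟩
    invert X D u v             ≈⟨ invert-inside X D inX ⟩
    D v u                      ≈⟨ reverseOn-inside C D (from C⇔SymDiff (inj₁ (inX , ¬inY))) ⟨
    reverseOn C D u v          ∎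
  ... | no ¬inX | yes inY = begin
    invert Y (invert X D) u v  ≈⟨ invert-inside Y (invert X D) inY ⟩
    invert X D v u             ≈⟨ invert-outside X D (¬inX ∘ swap) ⟩
    D v u                      ≈⟨ reverseOn-inside C D (from C⇔SymDiff (inj₂ (¬inX , inY))) ⟨
    reverseOn C D u v          ∎
  ... | no ¬inX | no ¬inY = begin
    invert Y (invert X D) u v  ≈⟨ invert-outside Y (invert X D) ¬inY ⟩
    invert X D u v             ≈⟨ invert-outside X D ¬inX ⟩
    D u v                      ≈⟨ reverseOn-outside C D
                                    (neither⇒¬symDiff (BothIn X) (BothIn Y) ¬inX ¬inY ∘ to C⇔SymDiff) ⟨
    reverseOn C D u v          ∎

  invert-twice : (∀ u → ¬ C u u) →
                 (∀ {u v} → u ≢ v → C u v ⇔ SymDiff (BothIn X) (BothIn Y) u v) →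
                 ∀ u v → invert Y (invert X D) u v ⇔ reverseOn C D u v
  invert-twice C-irrefl C⇔SymDiff u v with u ≟ v
  ... | no u≢v   = invert-twice-off-diagonal (C⇔SymDiff u≢v)
  ... | yes refl = begin
    invert Y (invert X D) u u  ≈⟨ invert-diagonal Y (invert X D) u ⟩
    invert X D u u             ≈⟨ invert-diagonal X D u ⟩
    D u u                      ≈⟨ reverseOn-outside C D (C-irrefl u) ⟨
    reverseOn C D u u          ∎

PathEdge : (a b c : Fin n) → Digraph n
PathEdge a b c u v = ((u ≡ a × v ≡ b) ⊎ (u ≡ b × v ≡ a)) ⊎ ((u ≡ b × v ≡ c) ⊎ (u ≡ c × v ≡ b))

module _ {a b c : Fin n} where

  cycleEdge⇔pathEdges : ∀ {d u v} → CycleEdge a b c d u v ⇔ (PathEdge a b c u v ⊎ PathEdge c d a u v)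
  cycleEdge⇔pathEdges = mk⇔ assocˡ assocʳ

  pathEdge-irrefl : a ≢ b → b ≢ c → ∀ {u} → ¬ PathEdge a b c u u
  pathEdge-irrefl a≢b b≢c (inj₁ (inj₁ (refl , refl))) = a≢b refl
  pathEdge-irrefl a≢b b≢c (inj₁ (inj₂ (refl , refl))) = a≢b refl
  pathEdge-irrefl a≢b b≢c (inj₂ (inj₁ (refl , refl))) = b≢c refl
  pathEdge-irrefl a≢b b≢c (inj₂ (inj₂ (refl , refl))) = b≢c refl

  pathEdge⇒bothIn-triple : ∀ {u v} → PathEdge a b c u v → BothIn (triple a b c) u v
  pathEdge⇒bothIn-triple (inj₁ (inj₁ (refl , refl))) = p∈triple , q∈triple
  pathEdge⇒bothIn-triple (inj₁ (inj₂ (refl , refl))) = q∈triple , p∈triple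
  pathEdge⇒bothIn-triple (inj₂ (inj₁ (refl , refl))) = q∈triple , r∈triple
  pathEdge⇒bothIn-triple (inj₂ (inj₂ (refl , refl))) = r∈triple , q∈triple

  pathEdge⇒¬bothIn : ∀ {S u v} → b ∉ S → PathEdge a b c u v → ¬ BothIn S u v
  pathEdge⇒¬bothIn b∉S (inj₁ (inj₁ (refl , refl))) = b∉S ∘ proj₂
  pathEdge⇒¬bothIn b∉S (inj₁ (inj₂ (refl , refl))) = b∉S ∘ proj₁
  pathEdge⇒¬bothIn b∉S (inj₂ (inj₁ (refl , refl))) = b∉S ∘ proj₁
  pathEdge⇒¬bothIn b∉S (inj₂ (inj₂ (refl , refl))) = b∉S ∘ proj₂

  -- S serves only to exclude the chord {a, c}.
  bothIn-triple⇒pathEdge : ∀ {S u v} → a ∈ S → c ∈ S → u ≢ v →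
                           BothIn (triple a b c) u v → ¬ BothIn S u v → PathEdge a b c u v
  bothIn-triple⇒pathEdge {u = u} {v} a∈S c∈S u≢v (u∈ , v∈) ¬inS = go (x∈triple⁻ u∈) (x∈triple⁻ v∈)
    where
    go : u ≡ a ⊎ u ≡ b ⊎ u ≡ c → v ≡ a ⊎ v ≡ b ⊎ v ≡ c → PathEdge a b c u v
    go (inj₁ refl)        (inj₁ refl)        = contradiction refl u≢v
    go (inj₁ refl)        (inj₂ (inj₁ refl)) = inj₁ (inj₁ (refl , refl))
    go (inj₁ refl)        (inj₂ (inj₂ refl)) = contradiction (a∈S , c∈S) ¬inS
    go (inj₂ (inj₁ refl)) (inj₁ refl)        = inj₁ (inj₂ (refl , refl))
    go (inj₂ (inj₁ refl)) (inj₂ (inj₁ refl)) = contradiction refl u≢v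
    go (inj₂ (inj₁ refl)) (inj₂ (inj₂ refl)) = inj₂ (inj₁ (refl , refl))
    go (inj₂ (inj₂ refl)) (inj₁ refl)        = contradiction (c∈S , a∈S) ¬inS
    go (inj₂ (inj₂ refl)) (inj₂ (inj₁ refl)) = inj₂ (inj₂ (refl , refl))
    go (inj₂ (inj₂ refl)) (inj₂ (inj₂ refl)) = contradiction refl u≢v

module _ {w x y z : Fin n} where

  cycleEdge-irrefl : w ≢ x → x ≢ y → y ≢ z → z ≢ w → ∀ u → ¬ CycleEdge w x y z u u
  cycleEdge-irrefl w≢x x≢y y≢z z≢w u =
    [ pathEdge-irrefl w≢x x≢y , pathEdge-irrefl y≢z z≢w ] ∘ to cycleEdge⇔pathEdges

  cycleEdge⇔symDiff-triples : w ≢ x → w ≢ y → w ≢ z → x ≢ y → x ≢ z → y ≢ z →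
    ∀ {u v} → u ≢ v →
    CycleEdge w x y z u v ⇔ SymDiff (BothIn (triple w x y)) (BothIn (triple y z w)) u v
  cycleEdge⇔symDiff-triples w≢x w≢y w≢z x≢y x≢z y≢z u≢v = ⇔.trans cycleEdge⇔pathEdges (mk⇔
    [ (λ e → inj₁ (pathEdge⇒bothIn-triple e , pathEdge⇒¬bothIn x∉yzw e))
    , (λ e → inj₂ (pathEdge⇒¬bothIn z∉wxy e , pathEdge⇒bothIn-triple e)) ]
    [ (λ (inX , ¬inY) → inj₁ (bothIn-triple⇒pathEdge r∈triple p∈triple u≢v inX ¬inY))
    , (λ (¬inX , inY) → inj₂ (bothIn-triple⇒pathEdge r∈triple p∈triple u≢v inY ¬inX)) ])
    where
    x∉yzw : x ∉ triple y z w
    x∉yzw = x∉triple x≢y x≢z (w≢x ∘ sym)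
    z∉wxy : z ∉ triple w x y
    z∉wxy = x∉triple (w≢z ∘ sym) (x≢z ∘ sym) (y≢z ∘ sym)

lemma3p1 : (n : ℕ) (T : Digraph n) → IsTournament T → (π : Permutation′ n)
    → (a b c d : Fin n)
    → (π ⟨$⟩ʳ a) < (π ⟨$⟩ʳ b) → (π ⟨$⟩ʳ b) < (π ⟨$⟩ʳ c) → (π ⟨$⟩ʳ c) < (π ⟨$⟩ʳ d)
    → (w x y z : Fin n)
    → w ≢ x → w ≢ y → w ≢ z → x ≢ y → x ≢ z → y ≢ z
    → (∀ v → (v ≡ w ⊎ v ≡ x ⊎ v ≡ y ⊎ v ≡ z) ⇔ (v ≡ a ⊎ v ≡ b ⊎ v ≡ c ⊎ v ≡ d))
    → DL T π w x → DL T π x y → DL T π y z → DL T π z w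
    → Σ[ X ∈ Subset n ] Σ[ Y ∈ Subset n ] (∣ X ∣ ≡ 3 × ∣ Y ∣ ≡ 3 ×
    (∀ u v → invert Y (invert X T) u v ⇔ reverseCycle w x y z T u v))
lemma3p1 _ T _ _ _ _ _ _ _ _ _ w x y z w≢x w≢y w≢z x≢y x≢z y≢z _ _ _ _ _ =
  triple w x y , triple y z w ,
  ∣triple∣≡3 w≢x w≢y x≢y , ∣triple∣≡3 y≢z (w≢y ∘ sym) (w≢z ∘ sym) ,
  invert-twice (triple w x y) (triple y z w) (CycleEdge w x y z) T
    (cycleEdge-irrefl w≢x x≢y y≢z (w≢z ∘ sym))
    (cycleEdge⇔symDiff-triples w≢x w≢y w≢z x≢y x≢z y≢z)
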